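{- For all integers $t\geq 3$ and $\ell\geq 4$, we have $s_2(K_t,C_\ell)\geq 2(t-1)$.
   Context: For graphs $H_1,H_2$, a graph $G$ is $2$-Ramsey for $(H_1,H_2)$ if every red/blue coloring of the edges of $G$ contains a red copy of $H_1$ or a blue copy of $H_2$; it is Ramsey-minimal if moreover no proper subgraph of $G$ is $2$-Ramsey for $(H_1,H_2)$. $s_2(H_1,H_2)$ is the minimum of the minimum degree over all Ramsey-minimal graphs for $(H_1,H_2)$. $K_t$ is the complete graph on $t$ vertices and $C_\ell$ the cycle on $\ell$ vertices. -}

module Defs where

open import Data.Nat using (ℕ; zero; suc; _+_)
open import Data.Bool using (Bool; true; false; if_then_else_)
open import Data.Fin using (Fin; zero; suc)
import Data.Nat
open import Data.List using (List; map; allFin)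
open import Data.Nat.ListAction using (sum)
open import Data.Product using (Σ; ∃; _×_; _,_)
open import Data.Sum using (_⊎_)
open import Relation.Nullary using (¬_)
open import Relation.Binary.PropositionalEquality using (_≡_; _≢_)
open import Function.Definitions using (Injective; Surjective)

record Graph : Set where
  field
    n      : ℕ
    adj    : Fin n → Fin n → Bool
    sym    : ∀ u v → adj u v ≡ adj v u
    irrefl : ∀ u → adj u u ≡ false
open Graph public

Edge : (G : Graph) → Fin (n G) → Fin (n G) → Set
Edge G u v = adj G u v ≡ true

degree : (G : Graph) → Fin (n G) → ℕ
degree G u = sum (map (λ v → if adj G u v then 1 else 0) (allFin (n G)))

-- red/blue edge colourings: a symmetric map on vertex pairs (true = red, false = blue);
-- only its values on edges matter.
Colouring : Graph → Set
Colouring G = Σ (Fin (n G) → Fin (n G) → Bool) λ c → ∀ u v → c u v ≡ c v u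

colour : (G : Graph) → Colouring G → Fin (n G) → Fin (n G) → Bool
colour G (c , _) = c

RedEdge : (G : Graph) → Colouring G → Fin (n G) → Fin (n G) → Set
RedEdge G c u v = Edge G u v × colour G c u v ≡ true

BlueEdge : (G : Graph) → Colouring G → Fin (n G) → Fin (n G) → Set
BlueEdge G c u v = Edge G u v × colour G c u v ≡ false

next : ∀ {ℓ} → Fin ℓ → Fin ℓ
next {suc ℓ} i = Data.Fin.fromℕ< {Data.Nat._%_ (suc (Data.Fin.toℕ i)) (suc ℓ)}
                   (Data.Nat.DivMod.m%n<n (suc (Data.Fin.toℕ i)) (suc ℓ))
  where import Data.Nat.DivMod

RedClique : (G : Graph) → Colouring G → ℕ → Set
RedClique G c t = Σ (Fin t → Fin (n G)) λ f →
  Injective _≡_ _≡_ f × (∀ i j → i ≢ j → RedEdge G c (f i) (f j))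

BlueCycle : (G : Graph) → Colouring G → ℕ → Set
BlueCycle G c ℓ = Σ (Fin ℓ → Fin (n G)) λ f →
  Injective _≡_ _≡_ f × (∀ i → BlueEdge G c (f i) (f (next i)))

IsRamsey : ℕ → ℕ → Graph → Set
IsRamsey t ℓ G = ∀ (c : Colouring G) → RedClique G c t ⊎ BlueCycle G c ℓ

IsSubgraphVia : (H G : Graph) → (Fin (n H) → Fin (n G)) → Set
IsSubgraphVia H G f = Injective _≡_ _≡_ f × (∀ u v → Edge H u v → Edge G (f u) (f v))

Covers : (H G : Graph) → (Fin (n H) → Fin (n G)) → Set
Covers H G f = Surjective _≡_ _≡_ f ×
  (∀ x y → Edge G x y → Σ (Fin (n H)) λ u → Σ (Fin (n H)) λ v →
      f u ≡ x × f v ≡ y × Edge H u v)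

ProperSubgraph : Graph → Graph → Set
ProperSubgraph H G = Σ (Fin (n H) → Fin (n G)) λ f → IsSubgraphVia H G f × ¬ Covers H G f

IsRamseyMinimal : ℕ → ℕ → Graph → Set
IsRamseyMinimal t ℓ G = IsRamsey t ℓ G × (∀ H → ProperSubgraph H G → ¬ IsRamsey t ℓ H)

Fin' : Graph → Set
Fin' G = Fin (n G)

-- Suppose G is Ramsey-minimal for (K_t, C_ℓ) and a vertex u has degree < 2(t-1) = 2k.
-- We show that G − u is still Ramsey, contradicting minimality. Fix a colouring c of G − u.
-- For a set B of at most one neighbour of u, extend c to G by colouring the edges from u
-- blue towards B and red towards the other neighbours. A blue C_ℓ through u would need
-- two blue edges at u, so (as G is Ramsey) either c already has a red K_t or a blue C_ℓ,
-- or N(u) − B contains a red K_k. Now maintain sets X ⊆ Y ⊆ N(u) with all X–Y pairs red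
-- and |X| + |Y| ≥ 2k; since |Y| ≤ deg u < 2k, X has an element b. A red K_k inside
-- N(u) − b, say K, either completes (X − K) ∪ (Y ∩ K) to a red K_t, or lets us pass to
-- X ∩ K, Y ∪ K, which keeps the invariant and shrinks X. Starting from X = Y = K for
-- B = ∅, the process must end with a red K_t or a blue C_ℓ in G − u.
module Submission where

open import Defs hiding (n; sym)
open import Data.Nat using (ℕ; zero; suc; _+_; _*_; _∸_; _≤_; _<_; z≤n; s≤s; _≤?_)
open import Data.Nat.Properties
  using (+-suc; +-assoc; +-mono-≤; +-cancelʳ-≤; +-cancelʳ-<; ≤-trans; ≤-refl;
         ≤-pred; ≰⇒>; +-identityʳ; module ≤-Reasoning; n≤1+n; m≤n⇒m<n∨m≡n; <⇒≢; n<1+n; m<n⇒m<1+n)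
open import Data.Nat.Tactic.RingSolver using (solve-∀)
open import Data.Nat.DivMod using (_%_; m<n⇒m%n≡m; n%n≡0; m%n<n)
open import Data.Nat.Induction using (<-wellFounded)
open import Data.Nat.ListAction using (sum)
open import Data.Bool using (Bool; true; false; not; if_then_else_)
open import Data.Bool.Properties using (not-injective)
import Data.Empty
open import Data.Fin using (Fin; zero; suc; toℕ; fromℕ; inject₁; punchIn; punchOut; _≟_)
open import Data.Fin.Properties
  using (injective⇒≤; suc-injective; any?; toℕ-fromℕ<; toℕ-injective; toℕ<n; toℕ-fromℕ;
         toℕ-inject₁; punchIn-injective; punchInᵢ≢i; punchOut-cong; punchOut-punchIn;
         punchIn-punchOut)
open import Data.Fin.Subset
open import Data.Fin.Subset.Properties
  using (Empty-unique; ∣⊥∣≡0; ∉⊥; x∈⁅x⁆; x∈⁅y⁆⇒x≡y; x∈p∩q⁻; x∈p∪q⁺; x∈p∪q⁻; x∈∁p⇒x∉p;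
         p∩q⊆p; p⊆q⇒∣p∣≤∣q∣; p⊂q⇒∣p∣<∣q∣)
import Data.List as List
open import Data.List.Properties using (map-tabulate)
open import Data.Vec using (_∷_; []; here; there; tabulate; lookup)
open import Data.Vec.Properties using ([]=⇒lookup; lookup⇒[]=; lookup∘tabulate)
open import Data.Product using (∃; _×_; _,_; proj₁; proj₂)
open import Data.Sum using (_⊎_; inj₁; inj₂; [_,_]′)
open import Function using (_∘_)
open import Function.Definitions using (Injective)
open import Induction.WellFounded using (Acc; acc)
open import Relation.Nullary using (Dec; yes; no; contradiction)
open import Relation.Binary.PropositionalEquality

private variable
  n k : ℕ

-- Subsets of a finite set

∣p∩q∣+∣p∪q∣≡∣p∣+∣q∣ : ∀ (p q : Subset n) → ∣ p ∩ q ∣ + ∣ p ∪ q ∣ ≡ ∣ p ∣ + ∣ q ∣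
∣p∩q∣+∣p∪q∣≡∣p∣+∣q∣ []            []            = refl
∣p∩q∣+∣p∪q∣≡∣p∣+∣q∣ (inside  ∷ p) (inside  ∷ q) =
  cong suc (trans (+-suc _ _) (trans (cong suc (∣p∩q∣+∣p∪q∣≡∣p∣+∣q∣ p q)) (sym (+-suc _ _))))
∣p∩q∣+∣p∪q∣≡∣p∣+∣q∣ (inside  ∷ p) (outside ∷ q) =
  trans (+-suc _ _) (cong suc (∣p∩q∣+∣p∪q∣≡∣p∣+∣q∣ p q))
∣p∩q∣+∣p∪q∣≡∣p∣+∣q∣ (outside ∷ p) (inside  ∷ q) =
  trans (+-suc _ _) (trans (cong suc (∣p∩q∣+∣p∪q∣≡∣p∣+∣q∣ p q)) (sym (+-suc _ _)))
∣p∩q∣+∣p∪q∣≡∣p∣+∣q∣ (outside ∷ p) (outside ∷ q) = ∣p∩q∣+∣p∪q∣≡∣p∣+∣q∣ p q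

∣p∩q∣+∣p∩∁q∣≡∣p∣ : ∀ (p q : Subset n) → ∣ p ∩ q ∣ + ∣ p ∩ ∁ q ∣ ≡ ∣ p ∣
∣p∩q∣+∣p∩∁q∣≡∣p∣ []            []            = refl
∣p∩q∣+∣p∩∁q∣≡∣p∣ (inside  ∷ p) (inside  ∷ q) = cong suc (∣p∩q∣+∣p∩∁q∣≡∣p∣ p q)
∣p∩q∣+∣p∩∁q∣≡∣p∣ (inside  ∷ p) (outside ∷ q) =
  trans (+-suc _ _) (cong suc (∣p∩q∣+∣p∩∁q∣≡∣p∣ p q))
∣p∩q∣+∣p∩∁q∣≡∣p∣ (outside ∷ p) (_       ∷ q) = ∣p∩q∣+∣p∩∁q∣≡∣p∣ p q

Disjoint : Subset n → Subset n → Set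
Disjoint p q = Empty (p ∩ q)

∣p∪q∣≡∣p∣+∣q∣ : ∀ (p q : Subset n) → Disjoint p q → ∣ p ∪ q ∣ ≡ ∣ p ∣ + ∣ q ∣
∣p∪q∣≡∣p∣+∣q∣ {n} p q p∩q≡∅ = begin
  ∣ p ∪ q ∣             ≡⟨ cong (_+ ∣ p ∪ q ∣) (sym ∣p∩q∣≡0) ⟩
  ∣ p ∩ q ∣ + ∣ p ∪ q ∣ ≡⟨ ∣p∩q∣+∣p∪q∣≡∣p∣+∣q∣ p q ⟩
  ∣ p ∣ + ∣ q ∣         ∎
  where
  open ≡-Reasoning
  ∣p∩q∣≡0 : ∣ p ∩ q ∣ ≡ 0
  ∣p∩q∣≡0 = trans (cong ∣_∣ (Empty-unique p∩q≡∅)) (∣⊥∣≡0 n)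

∣p∩r∣+∣q∪r∣+∣p∩∁r∪q∩r∣≡∣p∣+∣q∣+∣r∣ : ∀ (p q r : Subset n) →
  ∣ p ∩ r ∣ + ∣ q ∪ r ∣ + ∣ (p ∩ ∁ r) ∪ (q ∩ r) ∣ ≡ ∣ p ∣ + ∣ q ∣ + ∣ r ∣
∣p∩r∣+∣q∪r∣+∣p∩∁r∪q∩r∣≡∣p∣+∣q∣+∣r∣ p q r = begin
  a + b + ∣ (p ∩ ∁ r) ∪ (q ∩ r) ∣
    ≡⟨ cong (a + b +_) (∣p∪q∣≡∣p∣+∣q∣ (p ∩ ∁ r) (q ∩ r) disjoint) ⟩
  a + b + (x + y)
    ≡⟨ regroup a b x y ⟩
  (a + x) + (y + b)
    ≡⟨ cong₂ _+_ (∣p∩q∣+∣p∩∁q∣≡∣p∣ p r) (∣p∩q∣+∣p∪q∣≡∣p∣+∣q∣ q r) ⟩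
  ∣ p ∣ + (∣ q ∣ + ∣ r ∣)
    ≡⟨ sym (+-assoc (∣ p ∣) (∣ q ∣) (∣ r ∣)) ⟩
  ∣ p ∣ + ∣ q ∣ + ∣ r ∣ ∎
  where
  open ≡-Reasoning
  a b x y : ℕ
  a = ∣ p ∩ r ∣
  b = ∣ q ∪ r ∣
  x = ∣ p ∩ ∁ r ∣
  y = ∣ q ∩ r ∣
  regroup : ∀ a b x y → a + b + (x + y) ≡ (a + x) + (y + b)
  regroup = solve-∀
  disjoint : Disjoint (p ∩ ∁ r) (q ∩ r)
  disjoint (z , z∈) with x∈p∩q⁻ (p ∩ ∁ r) (q ∩ r) z∈
  ... | z∈p∩∁r , z∈q∩r =
    x∈∁p⇒x∉p (proj₂ (x∈p∩q⁻ p (∁ r) z∈p∩∁r)) (proj₂ (x∈p∩q⁻ q r z∈q∩r))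

rank : ∀ {p : Subset n} {x} → x ∈ p → Fin ∣ p ∣
rank {p = inside  ∷ p} here        = zero
rank {p = inside  ∷ p} (there x∈p) = suc (rank x∈p)
rank {p = outside ∷ p} (there x∈p) = rank x∈p

rank-injective : ∀ {p : Subset n} {x y} (x∈p : x ∈ p) (y∈p : y ∈ p) →
  rank x∈p ≡ rank y∈p → x ≡ y
rank-injective {p = inside  ∷ p} here        here        _ = refl
rank-injective {p = inside  ∷ p} (there x∈p) (there y∈p) e =
  cong suc (rank-injective x∈p y∈p (suc-injective e))
rank-injective {p = outside ∷ p} (there x∈p) (there y∈p) e =
  cong suc (rank-injective x∈p y∈p e)

injection-into⇒≤∣p∣ : ∀ {p : Subset n} {f : Fin k → Fin n} →
  Injective _≡_ _≡_ f → (∀ i → f i ∈ p) → k ≤ ∣ p ∣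
injection-into⇒≤∣p∣ f-inj f∈p = injective⇒≤ (λ e → f-inj (rank-injective (f∈p _) (f∈p _) e))

≤∣p∣⇒injection-into : ∀ {p : Subset n} → k ≤ ∣ p ∣ →
  ∃ λ (f : Fin k → Fin n) → Injective _≡_ _≡_ f × (∀ i → f i ∈ p)
≤∣p∣⇒injection-into {k = zero} _ = (λ ()) , (λ {i} → contradiction i λ ()) , λ ()
≤∣p∣⇒injection-into {k = suc k} {p = inside ∷ p} (s≤s k≤∣p∣) with ≤∣p∣⇒injection-into k≤∣p∣
... | f , f-inj , f∈p = g , g-inj , g∈
  where
  g : Fin (suc k) → Fin (suc _)
  g zero    = zero
  g (suc i) = suc (f i)
  g-inj : Injective _≡_ _≡_ g
  g-inj {zero}  {zero}  _ = refl
  g-inj {suc i} {suc j} e = cong suc (f-inj (suc-injective e))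
  g∈ : ∀ i → g i ∈ inside ∷ p
  g∈ zero    = here
  g∈ (suc i) = there (f∈p i)
≤∣p∣⇒injection-into {k = suc k} {p = outside ∷ p} k<∣p∣ with ≤∣p∣⇒injection-into k<∣p∣
... | f , f-inj , f∈p = suc ∘ f , f-inj ∘ suc-injective , there ∘ f∈p

∣p∣≤∣q∣-by-injection : ∀ {p : Subset n} {q : Subset k} {f : Fin n → Fin k} →
  Injective _≡_ _≡_ f → (∀ {x} → x ∈ p → f x ∈ q) → ∣ p ∣ ≤ ∣ q ∣
∣p∣≤∣q∣-by-injection {p = p} f-inj f[p]⊆q with ≤∣p∣⇒injection-into {p = p} ≤-refl
... | e , e-inj , e∈p = injection-into⇒≤∣p∣ (e-inj ∘ f-inj) (f[p]⊆q ∘ e∈p)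

∣p∣>0⇒Nonempty : ∀ {p : Subset n} → 0 < ∣ p ∣ → Nonempty p
∣p∣>0⇒Nonempty ∣p∣>0 with ≤∣p∣⇒injection-into ∣p∣>0
... | f , _ , f∈p = f zero , f∈p zero

image : (Fin k → Fin n) → Subset n
image {k = zero}  f = ⊥
image {k = suc k} f = ⁅ f zero ⁆ ∪ image (f ∘ suc)

f[i]∈image : ∀ (f : Fin k → Fin n) i → f i ∈ image f
f[i]∈image f zero    = x∈p∪q⁺ (inj₁ (x∈⁅x⁆ (f zero)))
f[i]∈image f (suc i) = x∈p∪q⁺ (inj₂ (f[i]∈image (f ∘ suc) i))

∈image⇒∃ : ∀ {f : Fin k → Fin n} {x} → x ∈ image f → ∃ λ i → f i ≡ x
∈image⇒∃ {k = zero}  x∈ = contradiction x∈ ∉⊥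
∈image⇒∃ {k = suc k} {f = f} x∈ with x∈p∪q⁻ ⁅ f zero ⁆ (image (f ∘ suc)) x∈
... | inj₁ x∈⁅f0⁆ = zero , sym (x∈⁅y⁆⇒x≡y (f zero) x∈⁅f0⁆)
... | inj₂ x∈rest with ∈image⇒∃ x∈rest
...   | i , fi≡x = suc i , fi≡x

∈tabulate⁺ : ∀ {f : Fin n → Bool} {x} → f x ≡ true → x ∈ tabulate f
∈tabulate⁺ {f = f} {x} fx = lookup⇒[]= x (tabulate f) (trans (lookup∘tabulate f x) fx)

∈tabulate⁻ : ∀ {f : Fin n → Bool} {x} → x ∈ tabulate f → f x ≡ true
∈tabulate⁻ {f = f} {x} x∈ = trans (sym (lookup∘tabulate f x)) ([]=⇒lookup x∈)

sum-indicator≡∣tabulate∣ : ∀ (b : Fin n → Bool) →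
  sum (List.tabulate (λ i → if b i then 1 else 0)) ≡ ∣ tabulate b ∣
sum-indicator≡∣tabulate∣ {zero}  b = refl
sum-indicator≡∣tabulate∣ {suc n} b with b zero
... | true  = cong suc (sum-indicator≡∣tabulate∣ (b ∘ suc))
... | false = sum-indicator≡∣tabulate∣ (b ∘ suc)

punchOut-punchIn′ : ∀ {i : Fin (suc n)} {x} (i≢x : i ≢ punchIn i x) → punchOut i≢x ≡ x
punchOut-punchIn′ {i = i} i≢x = trans (punchOut-cong i refl) (punchOut-punchIn i)

-- The cyclic successor

module _ {L : ℕ} where

  toℕ-next-< : (i : Fin (suc L)) → toℕ i < L → toℕ (next i) ≡ suc (toℕ i)
  toℕ-next-< i i<L =
    trans (toℕ-fromℕ< (m%n<n (suc (toℕ i)) (suc L))) (m<n⇒m%n≡m (s≤s i<L))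

  toℕ-next-last : (i : Fin (suc L)) → toℕ i ≡ L → toℕ (next i) ≡ 0
  toℕ-next-last i i≡L = trans (toℕ-fromℕ< (m%n<n (suc (toℕ i)) (suc L)))
    (trans (cong (λ j → suc j % suc L) i≡L) (n%n≡0 (suc L)))

  next-surjective : (i : Fin (suc L)) → ∃ λ j → next j ≡ i
  next-surjective zero = fromℕ L , toℕ-injective (toℕ-next-last (fromℕ L) (toℕ-fromℕ L))
  next-surjective (suc i) = inject₁ i , toℕ-injective (begin
    toℕ (next (inject₁ i)) ≡⟨ toℕ-next-< (inject₁ i) i<L ⟩
    suc (toℕ (inject₁ i))  ≡⟨ cong suc (toℕ-inject₁ i) ⟩
    suc (toℕ i)            ∎)
    where
    open ≡-Reasoning
    i<L : toℕ (inject₁ i) < L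
    i<L = subst (_< L) (sym (toℕ-inject₁ i)) (toℕ<n i)

  -- Two steps either move up by 2 or wrap around; wrapping lands on i only when L ≤ 1.
  next∘next≢id : 2 ≤ L → (i : Fin (suc L)) → next (next i) ≢ i
  next∘next≢id 2≤L i nni≡i =
    by-position (m≤n⇒m<n∨m≡n (≤-pred (toℕ<n i))) (m≤n⇒m<n∨m≡n (≤-pred (toℕ<n (next i))))
    where
    open ≡-Reasoning
    L≢0 : L ≢ 0
    L≢0 refl = contradiction 2≤L λ ()
    L≢1 : L ≢ 1
    L≢1 refl = contradiction 2≤L λ { (s≤s ()) }
    by-position : toℕ i < L ⊎ toℕ i ≡ L → toℕ (next i) < L ⊎ toℕ (next i) ≡ L → Data.Empty.⊥
    by-position (inj₁ i<L) (inj₁ ni<L) = <⇒≢ (m<n⇒m<1+n (n<1+n (toℕ i))) (sym (begin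
      suc (suc (toℕ i))         ≡⟨ cong suc (sym (toℕ-next-< i i<L)) ⟩
      suc (toℕ (next i))        ≡⟨ sym (toℕ-next-< (next i) ni<L) ⟩
      toℕ (next (next i))       ≡⟨ cong toℕ nni≡i ⟩
      toℕ i                     ∎))
    by-position (inj₁ i<L) (inj₂ ni≡L) = L≢1 (begin
      L                         ≡⟨ sym ni≡L ⟩
      toℕ (next i)              ≡⟨ toℕ-next-< i i<L ⟩
      suc (toℕ i)               ≡⟨ cong (suc ∘ toℕ) (sym nni≡i) ⟩
      suc (toℕ (next (next i))) ≡⟨ cong suc (toℕ-next-last (next i) ni≡L) ⟩
      1                         ∎)
    by-position (inj₂ i≡L) (inj₁ ni<L) = L≢1 (begin
      L                         ≡⟨ sym i≡L ⟩
      toℕ i                     ≡⟨ cong toℕ (sym nni≡i) ⟩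
      toℕ (next (next i))       ≡⟨ toℕ-next-< (next i) ni<L ⟩
      suc (toℕ (next i))        ≡⟨ cong suc (toℕ-next-last i i≡L) ⟩
      1                         ∎)
    by-position (inj₂ i≡L) (inj₂ ni≡L) = L≢0 (trans (sym ni≡L) (toℕ-next-last i i≡L))

-- Graphs and colourings

ColouredEdge : (G : Graph) → Colouring G → Bool → Fin' G → Fin' G → Set
ColouredEdge G c b x y = Edge G x y × colour G c x y ≡ b

ColouredEdge-sym : ∀ (G : Graph) c {b x y} → ColouredEdge G c b x y → ColouredEdge G c b y x
ColouredEdge-sym G (c , c-sym) {x = x} {y} (e , cxy) =
  trans (Graph.sym G y x) e , trans (c-sym y x) cxy

Edge⇒≢ : ∀ (G : Graph) {x y} → Edge G x y → x ≢ y
Edge⇒≢ G {x} e refl with trans (sym (Graph.irrefl G x)) e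
... | ()

degree≡∣neighbourhood∣ : ∀ (G : Graph) u → degree G u ≡ ∣ tabulate (adj G u) ∣
degree≡∣neighbourhood∣ G u = trans
  (cong sum (map-tabulate (λ v → v) (λ v → if adj G u v then 1 else 0)))
  (sum-indicator≡∣tabulate∣ (adj G u))

module VertexDeletion {m : ℕ} (adjG : Fin (suc m) → Fin (suc m) → Bool)
  (adjG-sym : ∀ x y → adjG x y ≡ adjG y x) (adjG-irrefl : ∀ x → adjG x x ≡ false)
  (u : Fin (suc m)) where

  G : Graph
  G = record { n = suc m ; adj = adjG ; sym = adjG-sym ; irrefl = adjG-irrefl }

  G-u : Graph
  G-u = record
    { n      = m
    ; adj    = λ x y → adjG (punchIn u x) (punchIn u y)
    ; sym    = λ x y → adjG-sym (punchIn u x) (punchIn u y)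
    ; irrefl = λ x → adjG-irrefl (punchIn u x)
    }

  G-u⊂G : ProperSubgraph G-u G
  G-u⊂G = punchIn u , (punchIn-injective u _ _ , λ _ _ e → e) ,
    λ (onto , _) → punchInᵢ≢i u _ (proj₂ (onto u) refl)

  N : Subset m
  N = tabulate (adjG u ∘ punchIn u)

  ∣N∣≤degree : ∣ N ∣ ≤ degree G u
  ∣N∣≤degree = subst (∣ N ∣ ≤_) (sym (degree≡∣neighbourhood∣ G u))
    (∣p∣≤∣q∣-by-injection {q = tabulate (adjG u)} (punchIn-injective u _ _)
      (λ x∈N → ∈tabulate⁺ {f = adjG u} (∈tabulate⁻ x∈N)))

  factor-through-punchIn : ∀ {A : Set} {f : A → Fin (suc m)} →
    Injective _≡_ _≡_ f → (∀ i → f i ≢ u) →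
    ∃ λ (g : A → Fin m) → Injective _≡_ _≡_ g × (∀ i → punchIn u (g i) ≡ f i)
  factor-through-punchIn {A} {f} f-inj f≢u = g , g-inj , g↑
    where
    g : A → Fin m
    g i = punchOut (f≢u i ∘ sym)
    g↑ : ∀ i → punchIn u (g i) ≡ f i
    g↑ i = punchIn-punchOut _
    g-inj : Injective _≡_ _≡_ g
    g-inj {i} {j} e = f-inj (trans (sym (g↑ i)) (trans (cong (punchIn u) e) (g↑ j)))

  module Extension (c : Colouring G-u) where

    -- B is the set of neighbours of u joined to u in blue; the value at (u, u) is junk.
    extended : Subset m → Fin (suc m) → Fin (suc m) → Bool
    extended B x y with u ≟ x | u ≟ y
    ... | yes _   | yes _   = true
    ... | yes _   | no u≢y = not (lookup B (punchOut u≢y))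
    ... | no u≢x | yes _   = not (lookup B (punchOut u≢x))
    ... | no u≢x | no u≢y = colour G-u c (punchOut u≢x) (punchOut u≢y)

    extended-sym : ∀ B x y → extended B x y ≡ extended B y x
    extended-sym B x y with u ≟ x | u ≟ y
    ... | yes _ | yes _ = refl
    ... | yes _ | no _  = refl
    ... | no _  | yes _ = refl
    ... | no _  | no _  = proj₂ c _ _

    extend : Subset m → Colouring G
    extend B = extended B , extended-sym B

    extended-punchIn : ∀ B x y → extended B (punchIn u x) (punchIn u y) ≡ colour G-u c x y
    extended-punchIn B x y with u ≟ punchIn u x | u ≟ punchIn u y
    ... | yes u≡x | _        = contradiction (sym u≡x) (punchInᵢ≢i u x)
    ... | no _    | yes u≡y  = contradiction (sym u≡y) (punchInᵢ≢i u y)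
    ... | no u≢x  | no u≢y  = cong₂ (colour G-u c) (punchOut-punchIn′ u≢x) (punchOut-punchIn′ u≢y)

    extended-u : ∀ B y → extended B u (punchIn u y) ≡ not (lookup B y)
    extended-u B y with u ≟ u | u ≟ punchIn u y
    ... | no u≢u  | _       = contradiction refl u≢u
    ... | yes _   | yes u≡y = contradiction (sym u≡y) (punchInᵢ≢i u y)
    ... | yes _   | no u≢y  = cong (not ∘ lookup B) (punchOut-punchIn′ u≢y)

    edge-pullback : ∀ B {b x y} → ColouredEdge G (extend B) b (punchIn u x) (punchIn u y) →
      ColouredEdge G-u c b x y
    edge-pullback B (e , col) = e , trans (sym (extended-punchIn B _ _)) col

    red-at-u⇒∉B : ∀ B {y} → RedEdge G (extend B) u (punchIn u y) → y ∉ B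
    red-at-u⇒∉B B {y} (_ , red) y∈B with trans (sym (extended-u B y)) red
    ... | not-lookup≡true rewrite []=⇒lookup y∈B = contradiction not-lookup≡true λ ()

    red-at-u⇒∈N : ∀ B {y} → RedEdge G (extend B) u (punchIn u y) → y ∈ N
    red-at-u⇒∈N B (e , _) = ∈tabulate⁺ e

    blue-at-u⇒∈B : ∀ B {x} → BlueEdge G (extend B) u x → ∃ λ y → y ∈ B × punchIn u y ≡ x
    blue-at-u⇒∈B B {x} (e , blue) = y , lookup⇒[]= y B (not-injective not-lookup≡false) , y↑
      where
      u≢x : u ≢ x
      u≢x = Edge⇒≢ G e
      y : Fin m
      y = punchOut u≢x
      y↑ : punchIn u y ≡ x
      y↑ = punchIn-punchOut u≢x
      not-lookup≡false : not (lookup B y) ≡ false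
      not-lookup≡false =
        trans (sym (extended-u B y)) (subst (λ z → extended B u z ≡ false) (sym y↑) blue)

    redClique-pullback : ∀ {t} B (K : RedClique G (extend B) t) → (∀ i → proj₁ K i ≢ u) →
      RedClique G-u c t
    redClique-pullback B (f , f-inj , f-red) f≢u with factor-through-punchIn f-inj f≢u
    ... | g , g-inj , g↑ = g , g-inj , λ i j i≢j →
      edge-pullback B (subst₂ (RedEdge G (extend B)) (sym (g↑ i)) (sym (g↑ j)) (f-red i j i≢j))

    blueCycle-pullback : ∀ {ℓ} B (C : BlueCycle G (extend B) ℓ) → (∀ i → proj₁ C i ≢ u) →
      BlueCycle G-u c ℓ
    blueCycle-pullback B (f , f-inj , f-blue) f≢u with factor-through-punchIn f-inj f≢u
    ... | g , g-inj , g↑ = g , g-inj , λ i →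
      edge-pullback B
        (subst₂ (BlueEdge G (extend B)) (sym (g↑ i)) (sym (g↑ (next i))) (f-blue i))

    AllRed : Subset m → Subset m → Set
    AllRed X Y = ∀ {x y} → x ∈ X → y ∈ Y → x ≢ y → RedEdge G-u c x y

    record NeighbourClique (k : ℕ) (B : Subset m) : Set where
      field
        K      : Subset m
        K⊆N    : K ⊆ N
        K-red  : AllRed K K
        k≤∣K∣  : k ≤ ∣ K ∣
        K∩B≡∅ : ∀ {x} → x ∈ K → x ∉ B

    redClique-analysis : ∀ {k} B → RedClique G (extend B) (suc k) →
      RedClique G-u c (suc k) ⊎ NeighbourClique k B
    redClique-analysis {k} B K@(f , f-inj , f-red) with any? (λ i → f i ≟ u)
    ... | no u∉f = inj₁ (redClique-pullback B K (λ i fi≡u → u∉f (i , fi≡u)))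
    ... | yes (i , fi≡u)
      with factor-through-punchIn {f = f ∘ punchIn i} (punchIn-injective i _ _ ∘ f-inj)
             (λ j e → punchInᵢ≢i i j (f-inj (trans e (sym fi≡u))))
    ... | g , g-inj , g↑ = inj₂ (record
      { K     = image g
      ; K⊆N   = λ x∈ → with-preimage x∈ (red-at-u⇒∈N B ∘ red-to-u)
      ; K-red = red-within
      ; k≤∣K∣ = injection-into⇒≤∣p∣ g-inj (f[i]∈image g)
      ; K∩B≡∅ = λ x∈ → with-preimage x∈ (red-at-u⇒∉B B ∘ red-to-u)
      })
      where
      red-to-u : ∀ j → RedEdge G (extend B) u (punchIn u (g j))
      red-to-u j = subst₂ (RedEdge G (extend B)) fi≡u (sym (g↑ j))
        (f-red i (punchIn i j) (punchInᵢ≢i i j ∘ sym))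
      with-preimage : ∀ {P : Fin m → Set} {x} → x ∈ image g → (∀ j → P (g j)) → P x
      with-preimage x∈ Pg with ∈image⇒∃ {f = g} x∈
      ... | j , refl = Pg j
      red-within : AllRed (image g) (image g)
      red-within x∈ y∈ x≢y with ∈image⇒∃ {f = g} x∈ | ∈image⇒∃ {f = g} y∈
      ... | j₁ , refl | j₂ , refl = edge-pullback B
        (subst₂ (RedEdge G (extend B)) (sym (g↑ j₁)) (sym (g↑ j₂))
          (f-red _ _ (x≢y ∘ cong g ∘ punchIn-injective i _ _)))

    allRed⇒redClique : ∀ {t T} → AllRed T T → t ≤ ∣ T ∣ → RedClique G-u c t
    allRed⇒redClique T-red t≤∣T∣ with ≤∣p∣⇒injection-into t≤∣T∣
    ... | f , f-inj , f∈T = f , f-inj , λ i j i≢j → T-red (f∈T i) (f∈T j) (i≢j ∘ f-inj)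

    AtMostOne : Subset m → Set
    AtMostOne B = ∀ {x y} → x ∈ B → y ∈ B → x ≡ y

    ⁅x⁆-atMostOne : ∀ b → AtMostOne ⁅ b ⁆
    ⁅x⁆-atMostOne b x∈ y∈ = trans (x∈⁅y⁆⇒x≡y b x∈) (sym (x∈⁅y⁆⇒x≡y b y∈))

    -- A blue cycle through u would use two distinct blue edges at u, but B has at most one element.
    blueCycle-analysis : ∀ {L} → 2 ≤ L → ∀ B → AtMostOne B → BlueCycle G (extend B) (suc L) →
      BlueCycle G-u c (suc L)
    blueCycle-analysis 2≤L B B-small C@(f , f-inj , f-blue) with any? (λ i → f i ≟ u)
    ... | no u∉f = blueCycle-pullback B C (λ i fi≡u → u∉f (i , fi≡u))
    ... | yes (i , fi≡u) with next-surjective i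
    ... | j , nj≡i
      with blue-at-u⇒∈B B (subst (λ z → BlueEdge G (extend B) z (f (next i))) fi≡u (f-blue i))
         | blue-at-u⇒∈B B (ColouredEdge-sym G (extend B)
             (subst (BlueEdge G (extend B) (f j)) (trans (cong f nj≡i) fi≡u) (f-blue j)))
    ... | y₁ , y₁∈B , y₁↑ | y₂ , y₂∈B , y₂↑ =
      contradiction (trans (cong next nj≡i) ni≡j) (next∘next≢id 2≤L j)
      where
      ni≡j : next i ≡ j
      ni≡j = f-inj (trans (sym y₁↑) (trans (cong (punchIn u) (B-small y₁∈B y₂∈B)) y₂↑))

    module Growth (k L : ℕ) (2≤L : 2 ≤ L) (G-Ramsey : IsRamsey (suc k) (suc L) G)
      (degree<2k : degree G u < 2 * k) where

      Witness : Set
      Witness = RedClique G-u c (suc k) ⊎ BlueCycle G-u c (suc L)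

      neighbourClique : ∀ B → AtMostOne B → Witness ⊎ NeighbourClique k B
      neighbourClique B B-small with G-Ramsey (extend B)
      ... | inj₁ K with redClique-analysis B K
      ...   | inj₁ K′ = inj₁ (inj₁ K′)
      ...   | inj₂ C  = inj₂ C
      neighbourClique B B-small | inj₂ C = inj₁ (inj₂ (blueCycle-analysis 2≤L B B-small C))

      record Invariant (X Y : Subset m) : Set where
        field
          X⊆Y   : X ⊆ Y
          Y⊆N   : Y ⊆ N
          X-Y-red : AllRed X Y
          2k≤   : 2 * k ≤ ∣ X ∣ + ∣ Y ∣

      X-nonempty : ∀ {X Y} → Invariant X Y → Nonempty X
      X-nonempty {X} {Y} inv = ∣p∣>0⇒Nonempty (+-cancelʳ-< (∣ Y ∣) 0 (∣ X ∣) (begin-strict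
        ∣ Y ∣          ≤⟨ p⊆q⇒∣p∣≤∣q∣ Y⊆N ⟩
        ∣ N ∣          ≤⟨ ∣N∣≤degree ⟩
        degree G u     <⟨ degree<2k ⟩
        2 * k          ≤⟨ 2k≤ ⟩
        ∣ X ∣ + ∣ Y ∣  ∎))
        where
        open Invariant inv
        open ≤-Reasoning

      -- (X − K) ∪ (Y ∩ K) is a red clique; if it is too small to be a K_{k+1}, the counting
      -- identity for X, Y, K shows that X ∩ K, Y ∪ K still satisfy the size bound.
      exchange : ∀ {X Y B} → Invariant X Y → (C : NeighbourClique k B) →
        Witness ⊎ Invariant (X ∩ NeighbourClique.K C) (Y ∪ NeighbourClique.K C)
      exchange {X} {Y} inv C = by-size (suc k ≤? ∣ T ∣)
        where
        open NeighbourClique C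
        open Invariant inv
        T : Subset m
        T = (X ∩ ∁ K) ∪ (Y ∩ K)
        T-red : AllRed T T
        T-red {x} {y} x∈T y∈T x≢y
          with x∈p∪q⁻ (X ∩ ∁ K) (Y ∩ K) x∈T | x∈p∪q⁻ (X ∩ ∁ K) (Y ∩ K) y∈T
        ... | inj₁ x∈X∖K | inj₁ y∈X∖K =
          X-Y-red (proj₁ (x∈p∩q⁻ X (∁ K) x∈X∖K)) (X⊆Y (proj₁ (x∈p∩q⁻ X (∁ K) y∈X∖K))) x≢y
        ... | inj₁ x∈X∖K | inj₂ y∈Y∩K =
          X-Y-red (proj₁ (x∈p∩q⁻ X (∁ K) x∈X∖K)) (proj₁ (x∈p∩q⁻ Y K y∈Y∩K)) x≢y
        ... | inj₂ x∈Y∩K | inj₁ y∈X∖K = ColouredEdge-sym G-u c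
          (X-Y-red (proj₁ (x∈p∩q⁻ X (∁ K) y∈X∖K)) (proj₁ (x∈p∩q⁻ Y K x∈Y∩K)) (x≢y ∘ sym))
        ... | inj₂ x∈Y∩K | inj₂ y∈Y∩K =
          K-red (proj₂ (x∈p∩q⁻ Y K x∈Y∩K)) (proj₂ (x∈p∩q⁻ Y K y∈Y∩K)) x≢y
        by-size : Dec (suc k ≤ ∣ T ∣) → Witness ⊎ Invariant (X ∩ K) (Y ∪ K)
        by-size (yes k<∣T∣) = inj₁ (inj₁ (allRed⇒redClique T-red k<∣T∣))
        by-size (no  k≮∣T∣) = inj₂ (record
          { X⊆Y     = λ x∈X∩K → x∈p∪q⁺ (inj₂ (proj₂ (x∈p∩q⁻ X K x∈X∩K)))
          ; Y⊆N     = λ y∈Y∪K → [ Y⊆N , K⊆N ]′ (x∈p∪q⁻ Y K y∈Y∪K)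
          ; X-Y-red = λ x∈X∩K y∈Y∪K → [ X-Y-red (proj₁ (x∈p∩q⁻ X K x∈X∩K))
                                       , K-red (proj₂ (x∈p∩q⁻ X K x∈X∩K)) ]′ (x∈p∪q⁻ Y K y∈Y∪K)
          ; 2k≤     = +-cancelʳ-≤ ∣ T ∣ (2 * k) (∣ X ∩ K ∣ + ∣ Y ∪ K ∣) (begin
              2 * k + ∣ T ∣
                ≤⟨ +-mono-≤ 2k≤ (≤-trans ∣T∣≤k k≤∣K∣) ⟩
              ∣ X ∣ + ∣ Y ∣ + ∣ K ∣
                ≡⟨ sym (∣p∩r∣+∣q∪r∣+∣p∩∁r∪q∩r∣≡∣p∣+∣q∣+∣r∣ X Y K) ⟩
              ∣ X ∩ K ∣ + ∣ Y ∪ K ∣ + ∣ T ∣ ∎)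
          })
          where
          open ≤-Reasoning
          ∣T∣≤k : ∣ T ∣ ≤ k
          ∣T∣≤k = ≤-pred (≰⇒> k≮∣T∣)

      grow : ∀ X Y → Acc _<_ ∣ X ∣ → Invariant X Y → Witness
      grow X Y (acc smaller) inv with X-nonempty inv
      ... | b , b∈X with neighbourClique ⁅ b ⁆ (⁅x⁆-atMostOne b)
      ...   | inj₁ w = w
      ...   | inj₂ C with exchange inv C
      ...     | inj₁ w    = w
      ...     | inj₂ inv′ = grow (X ∩ K) (Y ∪ K) (smaller ∣X∩K∣<∣X∣) inv′
        where
        open NeighbourClique C
        ∣X∩K∣<∣X∣ : ∣ X ∩ K ∣ < ∣ X ∣
        ∣X∩K∣<∣X∣ = p⊂q⇒∣p∣<∣q∣
          (p∩q⊆p X K , b , b∈X , λ b∈X∩K → K∩B≡∅ (proj₂ (x∈p∩q⁻ X K b∈X∩K)) (x∈⁅x⁆ b))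

      witness : Witness
      witness with neighbourClique ⊥ (λ x∈⊥ → contradiction x∈⊥ ∉⊥)
      ... | inj₁ w = w
      ... | inj₂ C = grow K K (<-wellFounded ∣ K ∣) (record
        { X⊆Y     = λ x∈K → x∈K
        ; Y⊆N     = K⊆N
        ; X-Y-red = K-red
        ; 2k≤     = +-mono-≤ k≤∣K∣ (subst (_≤ ∣ K ∣) (sym (+-identityʳ k)) k≤∣K∣)
        })
        where open NeighbourClique C

  G-u-Ramsey : ∀ {k L} → 2 ≤ L → IsRamsey (suc k) (suc L) G → degree G u < 2 * k →
    IsRamsey (suc k) (suc L) G-u
  G-u-Ramsey {k} {L} 2≤L G-Ramsey degree<2k c =
    Extension.Growth.witness c k L 2≤L G-Ramsey degree<2k

proposition3p4 : (t ℓ : ℕ) → 3 ≤ t → 4 ≤ ℓ → (G : Graph) → IsRamseyMinimal t ℓ G →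
    ∀ (u : Fin' G) → 2 * (t ∸ 1) ≤ degree G u
proposition3p4 (suc k) (suc L) _ 4≤ℓ
  G@(record { n = suc m ; adj = a ; sym = a-sym ; irrefl = a-irrefl }) (G-Ramsey , G-minimal) u
  with 2 * k ≤? degree G u
... | yes 2k≤degree = 2k≤degree
... | no  2k≰degree = contradiction
  (G-u-Ramsey (≤-trans (n≤1+n 2) (≤-pred 4≤ℓ)) G-Ramsey (≰⇒> 2k≰degree))
  (G-minimal G-u G-u⊂G)
  where open VertexDeletion a a-sym a-irrefl u
proposition3p4 zero    _       _ _  _ _ _  = z≤n
proposition3p4 (suc k) zero    _ () _ _ _
proposition3p4 (suc k) (suc L) _ _  (record { n = zero }) _ ()
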